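{- For every positive integer $n$, the path $P_n$ on $n$ vertices satisfies $\mathcal{G}(P_n)=n\bmod 2$ for \textsc{Closed Geodetic Game}.
   Context: For vertices $x,y$, $\mathcal{I}(x,y)$ is the set of vertices on some shortest $x$–$y$ path ($\mathcal{I}(x,x)=\{x\}$); for a vertex set $S$, the geodetic closure is $(S)=\bigcup_{x,y\in S}\mathcal{I}(x,y)$. \textsc{Closed Geodetic Game} on a graph: starting from $S=\emptyset$, two players alternately add to $S$ a vertex not in the current closure $(S)$; when $(S)$ is the whole vertex set there is no legal move and the game ends; the player making the last move wins. The options of a position are the positions reachable by one legal move; the Sprague–Grundy value is $\mathcal{G}(P)=\operatorname{mex}\{\mathcal{G}(P'):P'\text{ an option of }P\}$, where $\operatorname{mex}(X)$ is the least nonnegative integer not in $X$. $\mathcal{G}(H)$ for a graph $H$ denotes the value of the initial position (nothing selected). -}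

module Defs where

open import Data.Nat using (ℕ; zero; suc; _+_; _≡ᵇ_)
open import Data.Fin using (Fin; toℕ)
open import Data.Bool using (Bool; true; false; _∧_; _∨_; not; if_then_else_)
open import Data.List using (List; []; _∷_; map; upTo; allFin; filterᵇ; findᵇ; length)
open import Data.Maybe using (Maybe; just; nothing)
open import Data.Bool.ListAction using (any)

Graph : ℕ → Set
Graph n = Fin n → Fin n → Bool

VSet : ℕ → Set
VSet n = Fin n → Bool

∅ : ∀ {n} → VSet n
∅ _ = false

_≟ᵇ_ : ∀ {n} → Fin n → Fin n → Bool
i ≟ᵇ j = toℕ i ≡ᵇ toℕ j

_⊕_ : ∀ {n} → VSet n → Fin n → VSet n
(S ⊕ v) w = S w ∨ (v ≟ᵇ w)

anyV : ∀ {n} → (Fin n → Bool) → Bool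
anyV {n} p = any p (allFin n)

reach : ∀ {n} → Graph n → ℕ → Fin n → Fin n → Bool
reach G zero    x y = x ≟ᵇ y
reach G (suc k) x y = reach G k x y ∨ anyV (λ z → reach G k x z ∧ G z y)

-- graph distance (nothing = no x–y path).  A shortest path has at most
-- n - 1 edges, so searching k ∈ {0,…,n} is exhaustive.
dist : ∀ {n} → Graph n → Fin n → Fin n → Maybe ℕ
dist {n} G x y = findᵇ (λ k → reach G k x y) (upTo (suc n))

inInterval : ∀ {n} → Graph n → Fin n → Fin n → Fin n → Bool
inInterval G x y z with dist G x y | dist G x z | dist G z y
... | just a | just b | just c = (b + c) ≡ᵇ a
... | _      | _      | _      = false

closure : ∀ {n} → Graph n → VSet n → VSet n
closure G S z = anyV (λ x → anyV (λ y → S x ∧ S y ∧ inInterval G x y z))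

moves : ∀ {n} → Graph n → VSet n → List (Fin n)
moves {n} G S = filterᵇ (λ v → not (closure G S v)) (allFin n)

elemℕ : ℕ → List ℕ → Bool
elemℕ k xs = any (λ x → x ≡ᵇ k) xs

-- mex of a finite list: least k ∉ xs (always ≤ length xs)
mex : List ℕ → ℕ
mex xs with findᵇ (λ k → not (elemℕ k xs)) (upTo (suc (length xs)))
... | just k  = k
... | nothing = length xs

-- Sprague–Grundy value of position S, computed with a depth bound
-- (fuel).  Every move adds a vertex not in (S) ⊇ S to S, so a play has
-- at most n moves and fuel n gives the exact value.
grundyF : ∀ {n} → Graph n → ℕ → VSet n → ℕ
grundyF G zero    S = 0
grundyF G (suc f) S = mex (map (λ v → grundyF G f (S ⊕ v)) (moves G S))

𝒢 : ∀ {n} → Graph n → ℕ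
𝒢 {n} G = grundyF G n ∅

pathGraph : (n : ℕ) → Graph n
pathGraph n i j = (suc (toℕ i) ≡ᵇ toℕ j) ∨ (suc (toℕ j) ≡ᵇ toℕ i)

{-# OPTIONS --safe #-}
-- After the first move, the geodetic closure of the selected set on a path is
-- the interval between its extreme vertices, so a position is described by the
-- numbers a and b of free vertices to the left and to the right of it, and a
-- move lowers one of them to any smaller value: the game is two-heap Nim.  Its
-- value is 0 iff a = b and 1 iff {a, b} = {2k, 2k + 1}.  The first move v
-- leaves the heaps v and n − 1 − v; for odd n the middle vertex gives an option
-- of value 0 and no option has value 1 (as a + b = n − 1 is even), while for
-- even n no option has value 0.
module Submission where

open import Defs
open import Data.Nat using (ℕ; zero; suc; _+_; _*_; _≤_; _<_; _%_; _⊓_; _⊔_; _≡ᵇ_; ∣_-_∣; z≤n; s≤s; z<s; s<s; s<s⁻¹; _≟_; _≤?_; _<?_)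
open import Data.Nat.Properties
open import Data.Nat.DivMod using (m*n%n≡0; [m+kn]%n≡m%n)
open import Data.Fin using (Fin; toℕ; fromℕ<; opposite)
open import Data.Fin.Properties using (toℕ-fromℕ<; toℕ<n; opposite-prop; opposite-involutive; pigeonhole)
open import Data.Bool using (Bool; true; false; T; not)
open import Data.Bool.Properties using (T-∨; T-∧)
open import Data.List using (List; map; findᵇ; applyUpTo; upTo; allFin; length; lookup)
open import Data.List.Relation.Unary.Any as Any using (index; satisfied)
open import Data.List.Relation.Unary.Any.Properties using (any⁺; any⁻; lookup-index)
open import Data.List.Membership.Propositional using (_∈_; _∉_; lose)
open import Data.List.Membership.Propositional.Properties using (∈-allFin; ∈-map⁺; ∈-map⁻; ∈-filter⁺; ∈-filter⁻)
open import Data.Maybe using (just; nothing)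
open import Data.Product using (∃; _×_; _,_; proj₁; proj₂)
open import Data.Sum as Sum using (_⊎_; inj₁; inj₂; [_,_]′)
open import Data.Unit using (tt)
open import Function using (_∘_; id; _⇔_; mk⇔; Equivalence)
open import Relation.Nullary using (¬_; Dec; yes; no; contradiction)
open import Relation.Nullary.Decidable using (T?)
open import Relation.Binary using (tri<; tri≈; tri>)
open import Relation.Binary.PropositionalEquality

open Equivalence using (to; from)

T-not : ∀ {b} → T (not b) ⇔ (¬ T b)
T-not {false} = mk⇔ (λ _ ()) (λ _ → tt)
T-not {true}  = mk⇔ (λ ()) (λ ¬⊤ → ¬⊤ tt)

¬T-not⇒T : ∀ {b} → ¬ T (not b) → T b
¬T-not⇒T {false} ¬⊤ = ¬⊤ tt
¬T-not⇒T {true}  _  = tt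

T-≡ᵇ : ∀ m n → T (m ≡ᵇ n) ⇔ m ≡ n
T-≡ᵇ m n = mk⇔ (≡ᵇ⇒≡ m n) (≡⇒≡ᵇ m n)

elemℕ⇔∈ : ∀ {k xs} → T (elemℕ k xs) ⇔ k ∈ xs
elemℕ⇔∈ {k} {xs} = mk⇔
  (Any.map (λ {x} x≡ᵇk → sym (≡ᵇ⇒≡ x k x≡ᵇk)) ∘ any⁻ _ xs)
  (any⁺ _ ∘ Any.map (λ {x} k≡x → ≡⇒≡ᵇ x k (sym k≡x)))

anyV⁺ : ∀ {n} (p : Fin n → Bool) {x} → T (p x) → T (anyV p)
anyV⁺ p {x} px = any⁺ p (lose (∈-allFin x) px)

anyV⁻ : ∀ {n} (p : Fin n → Bool) → T (anyV p) → ∃ λ x → T (p x)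
anyV⁻ {n} p h = satisfied (any⁻ p (allFin n) h)

findᵇ-applyUpTo-just : ∀ (p : ℕ → Bool) f N {k} → findᵇ p (applyUpTo f N) ≡ just k →
                       ∃ λ i → f i ≡ k × T (p k) × (∀ {j} → j < i → ¬ T (p (f j)))
findᵇ-applyUpTo-just p f (suc N) eq with p (f 0) in p0
... | true with refl ← eq = 0 , refl , subst T (sym p0) tt , λ ()
... | false with i , fi≡k , pk , below ← findᵇ-applyUpTo-just p (f ∘ suc) N eq =
  suc i , fi≡k , pk , λ { {zero} _ → subst T p0 ; {suc j} j<i → below (s<s⁻¹ j<i) }

findᵇ-applyUpTo-nothing : ∀ (p : ℕ → Bool) f N → findᵇ p (applyUpTo f N) ≡ nothing →
                          ∀ {j} → j < N → ¬ T (p (f j))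
findᵇ-applyUpTo-nothing p f (suc N) eq {j} j<N with p (f 0) in p0
findᵇ-applyUpTo-nothing p f (suc N) () j<N | true
findᵇ-applyUpTo-nothing p f (suc N) eq {zero}  j<N | false = subst T p0
findᵇ-applyUpTo-nothing p f (suc N) eq {suc j} j<N | false =
  findᵇ-applyUpTo-nothing p (f ∘ suc) N eq (s<s⁻¹ j<N)

¬covers≤length : ∀ xs → ¬ (∀ {k} → k ≤ length xs → k ∈ xs)
¬covers≤length xs covers =
  let i , j , i<j , same = pigeonhole ≤-refl position in
  <-irrefl (trans (lookup-position i) (trans (cong (lookup xs) same) (sym (lookup-position j)))) i<j
  where
  position : Fin (suc (length xs)) → Fin (length xs)
  position i = index (covers (≤-pred (toℕ<n i)))
  lookup-position : ∀ i → toℕ i ≡ lookup xs (position i)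
  lookup-position i = lookup-index (covers (≤-pred (toℕ<n i)))

absentFrom : List ℕ → ℕ → Bool
absentFrom xs k = not (elemℕ k xs)

mex-∉ : ∀ xs → mex xs ∉ xs
mex-∉ xs with findᵇ (absentFrom xs) (upTo (suc (length xs))) in eq
... | just k with _ , _ , k-missing , _ ← findᵇ-applyUpTo-just (absentFrom xs) id (suc (length xs)) eq =
  T-not .to k-missing ∘ elemℕ⇔∈ .from
... | nothing = contradiction (λ {k} → covers {k}) (¬covers≤length xs)
  where
  covers : ∀ {k} → k ≤ length xs → k ∈ xs
  covers k≤ = elemℕ⇔∈ .to (¬T-not⇒T (findᵇ-applyUpTo-nothing (absentFrom xs) id (suc (length xs)) eq (s≤s k≤)))

mex-minimal : ∀ xs {k} → k < mex xs → k ∈ xs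
mex-minimal xs {k} k<mex with findᵇ (absentFrom xs) (upTo (suc (length xs))) in eq
... | just m with _ , refl , _ , below ← findᵇ-applyUpTo-just (absentFrom xs) id (suc (length xs)) eq =
  elemℕ⇔∈ .to (¬T-not⇒T (below k<mex))
... | nothing = elemℕ⇔∈ .to (¬T-not⇒T (findᵇ-applyUpTo-nothing (absentFrom xs) id (suc (length xs)) eq (m≤n⇒m≤1+n k<mex)))

mex≡0 : ∀ {xs} → 0 ∉ xs → mex xs ≡ 0
mex≡0 {xs} 0∉ with mex xs | mex-minimal xs
... | zero  | _     = refl
... | suc _ | below = contradiction (below z<s) 0∉

mex≡1 : ∀ {xs} → 0 ∈ xs → 1 ∉ xs → mex xs ≡ 1
mex≡1 {xs} 0∈ 1∉ with mex xs | mex-∉ xs | mex-minimal xs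
... | zero        | 0∉ | _     = contradiction 0∈ 0∉
... | suc zero    | _  | _     = refl
... | suc (suc _) | _  | below = contradiction (below (s<s z<s)) 1∉

2≤mex : ∀ {xs} → 0 ∈ xs → 1 ∈ xs → 2 ≤ mex xs
2≤mex {xs} 0∈ 1∈ with mex xs | mex-∉ xs
... | zero        | 0∉ = contradiction 0∈ 0∉
... | suc zero    | 1∉ = contradiction 1∈ 1∉
... | suc (suc _) | _  = s≤s (s≤s z≤n)

-- twin n is n XOR 1.
twin : ℕ → ℕ
twin zero          = 1
twin (suc zero)    = 0
twin (suc (suc n)) = suc (suc (twin n))

twin-involutive : ∀ n → twin (twin n) ≡ n
twin-involutive zero          = refl
twin-involutive (suc zero)    = refl
twin-involutive (suc (suc n)) = cong (suc ∘ suc) (twin-involutive n)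

twin-injective : ∀ {m n} → twin m ≡ twin n → m ≡ n
twin-injective {m} {n} eq = begin
  m               ≡⟨ twin-involutive m ⟨
  twin (twin m)   ≡⟨ cong twin eq ⟩
  twin (twin n)   ≡⟨ twin-involutive n ⟩
  n               ∎
  where open ≡-Reasoning

n≢twin[n] : ∀ n → n ≢ twin n
n≢twin[n] zero          ()
n≢twin[n] (suc zero)    ()
n≢twin[n] (suc (suc n)) eq = n≢twin[n] n (suc-injective (suc-injective eq))

twin≤1+n : ∀ n → twin n ≤ suc n
twin≤1+n zero          = ≤-refl
twin≤1+n (suc zero)    = z≤n
twin≤1+n (suc (suc n)) = s≤s (s≤s (twin≤1+n n))

[n+twin[n]]%2≡1 : ∀ n → (n + twin n) % 2 ≡ 1
[n+twin[n]]%2≡1 zero          = refl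
[n+twin[n]]%2≡1 (suc zero)    = refl
[n+twin[n]]%2≡1 (suc (suc n)) rewrite +-suc n (suc (twin n)) | +-suc n (twin n) = [n+twin[n]]%2≡1 n

n*2≡n+n : ∀ n → n * 2 ≡ n + n
n*2≡n+n n = trans (*-comm n 2) (cong (n +_) (+-identityʳ n))

-- CappedNim a b g says g ⊓ 2 ≡ (a XOR b) ⊓ 2, where a XOR b is the value of
-- two-heap Nim at (a, b).
data CappedNim (a b : ℕ) : ℕ → Set where
  same     : a ≡ b → CappedNim a b 0
  partners : b ≡ twin a → CappedNim a b 1
  apart    : ∀ {g} → a ≢ b → b ≢ twin a → 2 ≤ g → CappedNim a b g

CappedNim-0⇒≡ : ∀ {a b} → CappedNim a b 0 → a ≡ b
CappedNim-0⇒≡ (same a≡b) = a≡b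

CappedNim-1⇒twin : ∀ {a b} → CappedNim a b 1 → b ≡ twin a
CappedNim-1⇒twin (partners b≡twin) = b≡twin
CappedNim-1⇒twin (apart _ _ (s≤s ()))

CappedNim-≡⇒0 : ∀ {a b g} → a ≡ b → CappedNim a b g → g ≡ 0
CappedNim-≡⇒0 _        (same _)           = refl
CappedNim-≡⇒0 refl     (partners a≡twin)  = contradiction a≡twin (n≢twin[n] _)
CappedNim-≡⇒0 a≡b      (apart a≢b _ _)    = contradiction a≡b a≢b

CappedNim-twin⇒1 : ∀ {a b g} → b ≡ twin a → CappedNim a b g → g ≡ 1
CappedNim-twin⇒1 refl (same a≡twin)       = contradiction a≡twin (n≢twin[n] _)
CappedNim-twin⇒1 _    (partners _)         = refl
CappedNim-twin⇒1 b≡twin (apart _ b≢twin _) = contradiction b≡twin b≢twin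

CappedNim-0-even : ∀ {a b} → CappedNim a b 0 → (a + b) % 2 ≡ 0
CappedNim-0-even {a} (same refl) = trans (cong (_% 2) (sym (n*2≡n+n a))) (m*n%n≡0 a 2)

CappedNim-1-odd : ∀ {a b} → CappedNim a b 1 → (a + b) % 2 ≡ 1
CappedNim-1-odd {a} c = trans (cong (λ b → (a + b) % 2) (CappedNim-1⇒twin c)) ([n+twin[n]]%2≡1 a)

record NimOptions (a b : ℕ) (xs : List ℕ) : Set where
  field
    sound : ∀ {g} → g ∈ xs →
            (∃ λ a′ → a′ < a × CappedNim a′ b g) ⊎ (∃ λ b′ → b′ < b × CappedNim a b′ g)
    left  : ∀ {a′} → a′ < a → ∃ λ g → g ∈ xs × CappedNim a′ b g
    right : ∀ {b′} → b′ < b → ∃ λ g → g ∈ xs × CappedNim a b′ g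

mex-CappedNim : ∀ {a b xs} → NimOptions a b xs → CappedNim a b (mex xs)
mex-CappedNim {a} {b} {xs} options = classify (a ≟ b) (b ≟ twin a)
  where
  open NimOptions options

  twin< : ∀ {x y} → x < y → twin x ≢ y → twin x < y
  twin< x<y = ≤∧≢⇒< (≤-trans (twin≤1+n _) x<y)

  0∈ : a ≢ b → 0 ∈ xs
  0∈ a≢b with <-cmp a b
  ... | tri< a<b _ _ = let g , g∈ , c = right a<b in subst (_∈ xs) (CappedNim-≡⇒0 refl c) g∈
  ... | tri≈ _ a≡b _ = contradiction a≡b a≢b
  ... | tri> _ _ b<a = let g , g∈ , c = left b<a in subst (_∈ xs) (CappedNim-≡⇒0 refl c) g∈

  1∈ : a ≢ b → b ≢ twin a → 1 ∈ xs
  1∈ a≢b b≢twin with <-cmp a b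
  ... | tri< a<b _ _ =
    let g , g∈ , c = right (twin< a<b (b≢twin ∘ sym)) in
    subst (_∈ xs) (CappedNim-twin⇒1 refl c) g∈
  ... | tri≈ _ a≡b _ = contradiction a≡b a≢b
  ... | tri> _ _ b<a =
    let g , g∈ , c = left (twin< b<a (λ twin≡a → b≢twin (trans (sym (twin-involutive b)) (cong twin twin≡a)))) in
    subst (_∈ xs) (CappedNim-twin⇒1 (sym (twin-involutive b)) c) g∈

  classify : Dec (a ≡ b) → Dec (b ≡ twin a) → CappedNim a b (mex xs)
  classify (yes a≡b) _ = subst (CappedNim a b) (sym (mex≡0 0∉)) (same a≡b)
    where
    0∉ : 0 ∉ xs
    0∉ 0∈ with sound 0∈
    ... | inj₁ (a′ , a′<a , c) = <-irrefl (trans (CappedNim-0⇒≡ c) (sym a≡b)) a′<a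
    ... | inj₂ (b′ , b′<b , c) = <-irrefl (trans (sym (CappedNim-0⇒≡ c)) a≡b) b′<b
  classify (no a≢b) (yes b≡twin) = subst (CappedNim a b) (sym (mex≡1 (0∈ a≢b) 1∉)) (partners b≡twin)
    where
    1∉ : 1 ∉ xs
    1∉ 1∈ with sound 1∈
    ... | inj₁ (a′ , a′<a , c) = <-irrefl (twin-injective (trans (sym (CappedNim-1⇒twin c)) b≡twin)) a′<a
    ... | inj₂ (b′ , b′<b , c) = <-irrefl (trans (CappedNim-1⇒twin c) (sym b≡twin)) b′<b
  classify (no a≢b) (no b≢twin) = apart a≢b b≢twin (2≤mex (0∈ a≢b) (1∈ a≢b b≢twin))

∣m-1+m∣≡1 : ∀ m → ∣ m - suc m ∣ ≡ 1
∣m-1+m∣≡1 zero    = refl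
∣m-1+m∣≡1 (suc m) = ∣m-1+m∣≡1 m

∣m-n∣≡1⇒ : ∀ m n → ∣ m - n ∣ ≡ 1 → suc m ≡ n ⊎ suc n ≡ m
∣m-n∣≡1⇒ zero          (suc zero)    _  = inj₁ refl
∣m-n∣≡1⇒ (suc zero)    zero          _  = inj₂ refl
∣m-n∣≡1⇒ (suc m)       (suc n)       eq = Sum.map (cong suc) (cong suc) (∣m-n∣≡1⇒ m n eq)
∣m-n∣≡1⇒ zero          zero          ()
∣m-n∣≡1⇒ zero          (suc (suc n)) ()
∣m-n∣≡1⇒ (suc (suc m)) zero          ()

∣m-n∣≡1+k⇒neighbour : ∀ m n {k} → ∣ m - n ∣ ≡ suc k → ∃ λ o → ∣ m - o ∣ ≡ k × ∣ o - n ∣ ≡ 1 × o ≤ m ⊔ n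
∣m-n∣≡1+k⇒neighbour zero    (suc n) refl = n , refl , ∣m-1+m∣≡1 n , n≤1+n n
∣m-n∣≡1+k⇒neighbour (suc m) zero    refl = 1 , ∣-∣-identityʳ m , refl , s≤s z≤n
∣m-n∣≡1+k⇒neighbour (suc m) (suc n) eq   =
  let o , mo , on , o≤ = ∣m-n∣≡1+k⇒neighbour m n eq in suc o , mo , on , s≤s o≤

∣-∣-between : ∀ {x y z} → x ≤ z → z ≤ y → ∣ x - z ∣ + ∣ z - y ∣ ≡ ∣ x - y ∣
∣-∣-between {zero}  {y} {z} _ z≤y = trans (cong (z +_) (m≤n⇒∣m-n∣≡n∸m z≤y)) (m+[n∸m]≡n z≤y)
∣-∣-between {suc x} {suc y} {suc z} (s≤s x≤z) (s≤s z≤y) = ∣-∣-between x≤z z≤y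

geodesic⇒⊓≤ : ∀ x y z → ∣ x - z ∣ + ∣ z - y ∣ ≡ ∣ x - y ∣ → x ⊓ y ≤ z
geodesic⇒⊓≤ zero    y       z       _  = z≤n
geodesic⇒⊓≤ (suc x) zero    z       _  = z≤n
geodesic⇒⊓≤ (suc x) (suc y) zero    eq = contradiction (sym eq) (<⇒≢ (begin-strict
  ∣ x - y ∣       ≤⟨ ∣m-n∣≤m⊔n x y ⟩
  x ⊔ y           ≤⟨ m⊔n≤m+n x y ⟩
  x + y           <⟨ +-monoʳ-< x (n<1+n y) ⟩
  x + suc y       <⟨ n<1+n _ ⟩
  suc x + suc y   ∎))
  where open ≤-Reasoning
geodesic⇒⊓≤ (suc x) (suc y) (suc z) eq = s≤s (geodesic⇒⊓≤ x y z eq)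

geodesic⇒≤⊔ : ∀ x y z → ∣ x - z ∣ + ∣ z - y ∣ ≡ ∣ x - y ∣ → z ≤ x ⊔ y
geodesic⇒≤⊔ x       y       zero    _  = z≤n
geodesic⇒≤⊔ zero    zero    (suc z) ()
geodesic⇒≤⊔ zero    (suc y) (suc z) eq = s≤s (≤-trans (m≤m+n z _) (≤-reflexive (suc-injective eq)))
geodesic⇒≤⊔ (suc x) zero    (suc z) eq = s≤s (≤-trans (m≤n+m z _) (≤-reflexive (suc-injective (trans (sym (+-suc _ z)) eq))))
geodesic⇒≤⊔ (suc x) (suc y) (suc z) eq = s≤s (geodesic⇒≤⊔ x y z eq)

opposite-< : ∀ {n} {i j : Fin n} → toℕ i < toℕ j → toℕ (opposite j) < toℕ (opposite i)
opposite-< {n} {i} {j} i<j =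
  subst₂ _<_ (sym (opposite-prop j)) (sym (opposite-prop i)) (∸-monoʳ-< (s<s i<j) (toℕ<n j))

toℕ+toℕ-opposite : ∀ {m} (v : Fin (suc m)) → toℕ v + toℕ (opposite v) ≡ m
toℕ+toℕ-opposite v = trans (cong (toℕ v +_) (opposite-prop v)) (m+[n∸m]≡n (≤-pred (toℕ<n v)))

module _ {n : ℕ} where

  ∈-moves : ∀ {G : Graph n} {S v} → v ∈ moves G S ⇔ (¬ T (closure G S v))
  ∈-moves {G} {S} {v} = mk⇔
    (T-not .to ∘ proj₂ ∘ ∈-filter⁻ (T? ∘ outside) {xs = allFin n})
    (∈-filter⁺ (T? ∘ outside) (∈-allFin v) ∘ T-not .from)
    where
    outside : Fin n → Bool
    outside w = not (closure G S w)

  closure-∅ : ∀ (G : Graph n) v → ¬ T (closure G ∅ v)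
  closure-∅ G v v∈ = proj₂ (anyV⁻ {n} (λ _ → false) (proj₂ (anyV⁻ {n} (λ _ → anyV {n} (λ _ → false)) v∈)))

  ⊕-new : ∀ (S : VSet n) v → T ((S ⊕ v) v)
  ⊕-new S v = T-∨ .from (inj₂ (≡⇒≡ᵇ (toℕ v) (toℕ v) refl))

  ⊕-old : ∀ {S : VSet n} {v w} → T (S w) → T ((S ⊕ v) w)
  ⊕-old = T-∨ .from ∘ inj₁

  ⊕⁻ : ∀ {S : VSet n} {v w} → T ((S ⊕ v) w) → T (S w) ⊎ toℕ v ≡ toℕ w
  ⊕⁻ = Sum.map₂ (≡ᵇ⇒≡ _ _) ∘ T-∨ .to

  record Extremes (S : VSet n) (l r : Fin n) : Set where
    field
      least    : T (S l)
      greatest : T (S r)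
      bounded  : ∀ {z} → T (S z) → toℕ l ≤ toℕ z × toℕ z ≤ toℕ r

    l≤r : toℕ l ≤ toℕ r
    l≤r = proj₂ (bounded least)

  Extremes-singleton : ∀ v → Extremes (∅ ⊕ v) v v
  Extremes-singleton v = record
    { least    = ⊕-new ∅ v
    ; greatest = ⊕-new ∅ v
    ; bounded  = λ z∈ → [ (λ ()) , (λ v≡z → ≤-reflexive v≡z , ≤-reflexive (sym v≡z)) ]′ (⊕⁻ z∈)
    }

  Extremes-⊕ˡ : ∀ {S l r v} → Extremes S l r → toℕ v < toℕ l → Extremes (S ⊕ v) v r
  Extremes-⊕ˡ {S} {l} {r} {v} ext v<l = record
    { least    = ⊕-new S v
    ; greatest = ⊕-old {S} {v} greatest
    ; bounded  = [ (λ z∈ → ≤-trans (<⇒≤ v<l) (proj₁ (bounded z∈)) , proj₂ (bounded z∈))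
                 , (λ v≡z → ≤-reflexive v≡z , subst (_≤ toℕ r) v≡z (≤-trans (<⇒≤ v<l) l≤r)) ]′ ∘ ⊕⁻ {S}
    }
    where open Extremes ext

  Extremes-⊕ʳ : ∀ {S l r v} → Extremes S l r → toℕ r < toℕ v → Extremes (S ⊕ v) l v
  Extremes-⊕ʳ {S} {l} {r} {v} ext r<v = record
    { least    = ⊕-old {S} {v} least
    ; greatest = ⊕-new S v
    ; bounded  = [ (λ z∈ → proj₁ (bounded z∈) , ≤-trans (proj₂ (bounded z∈)) (<⇒≤ r<v))
                 , (λ v≡z → subst (toℕ l ≤_) v≡z (≤-trans l≤r (<⇒≤ r<v)) , ≤-reflexive (sym v≡z)) ]′ ∘ ⊕⁻ {S}
    }
    where open Extremes ext

module _ {n : ℕ} where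

  private
    P : Graph n
    P = pathGraph n

  pathGraph-adjacent : ∀ (x y : Fin n) → T (P x y) ⇔ ∣ toℕ x - toℕ y ∣ ≡ 1
  pathGraph-adjacent x y = mk⇔
    (distance-1 ∘ Sum.map (≡ᵇ⇒≡ _ _) (≡ᵇ⇒≡ _ _) ∘ T-∨ .to)
    (T-∨ .from ∘ Sum.map (≡⇒≡ᵇ _ _) (≡⇒≡ᵇ _ _) ∘ ∣m-n∣≡1⇒ (toℕ x) (toℕ y))
    where
    distance-1 : suc (toℕ x) ≡ toℕ y ⊎ suc (toℕ y) ≡ toℕ x → ∣ toℕ x - toℕ y ∣ ≡ 1
    distance-1 (inj₁ eq) = subst (λ o → ∣ toℕ x - o ∣ ≡ 1) eq (∣m-1+m∣≡1 (toℕ x))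
    distance-1 (inj₂ eq) = subst (λ o → ∣ o - toℕ y ∣ ≡ 1) eq (trans (∣-∣-comm (suc (toℕ y)) (toℕ y)) (∣m-1+m∣≡1 (toℕ y)))

  reach-sound : ∀ k (x y : Fin n) → T (reach P k x y) → ∣ toℕ x - toℕ y ∣ ≤ k
  reach-sound zero    x y h = ≤-reflexive (m≡n⇒∣m-n∣≡0 (≡ᵇ⇒≡ (toℕ x) (toℕ y) h))
  reach-sound (suc k) x y h with T-∨ .to h
  ... | inj₁ h′ = m≤n⇒m≤1+n (reach-sound k x y h′)
  ... | inj₂ h′ = let z , hz = anyV⁻ _ h′ ; x~>z , z~y = T-∧ .to hz in begin
    ∣ toℕ x - toℕ y ∣                     ≤⟨ ∣-∣-triangle (toℕ x) (toℕ z) (toℕ y) ⟩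
    ∣ toℕ x - toℕ z ∣ + ∣ toℕ z - toℕ y ∣ ≡⟨ cong (∣ toℕ x - toℕ z ∣ +_) (pathGraph-adjacent z y .to z~y) ⟩
    ∣ toℕ x - toℕ z ∣ + 1                 ≤⟨ +-monoˡ-≤ 1 (reach-sound k x z x~>z) ⟩
    k + 1                                 ≡⟨ +-comm k 1 ⟩
    suc k                                 ∎
    where open ≤-Reasoning

  reach-complete : ∀ k (x y : Fin n) → ∣ toℕ x - toℕ y ∣ ≤ k → T (reach P k x y)
  reach-complete zero    x y d≤0 = ≡⇒≡ᵇ (toℕ x) (toℕ y) (∣m-n∣≡0⇒m≡n (n≤0⇒n≡0 d≤0))
  reach-complete (suc k) x y d≤1+k with ∣ toℕ x - toℕ y ∣ ≤? k
  ... | yes d≤k = T-∨ .from (inj₁ (reach-complete k x y d≤k))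
  ... | no d≰k with o , x~>o , o~y , o≤x⊔y ← ∣m-n∣≡1+k⇒neighbour (toℕ x) (toℕ y) (≤-antisym d≤1+k (≰⇒> d≰k)) =
    T-∨ .from (inj₂ (anyV⁺ _ {z} (T-∧ .from (reach-complete k x z x~>z , pathGraph-adjacent z y .from z~y))))
    where
    o<n : o < n
    o<n = ≤-<-trans o≤x⊔y (⊔-lub (toℕ<n x) (toℕ<n y))
    z : Fin n
    z = fromℕ< o<n
    x~>z : ∣ toℕ x - toℕ z ∣ ≤ k
    x~>z = ≤-reflexive (trans (cong (∣ toℕ x -_∣) (toℕ-fromℕ< o<n)) x~>o)
    z~y : ∣ toℕ z - toℕ y ∣ ≡ 1
    z~y = trans (cong (∣_- toℕ y ∣) (toℕ-fromℕ< o<n)) o~y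

  dist-pathGraph : ∀ (x y : Fin n) → dist P x y ≡ just ∣ toℕ x - toℕ y ∣
  dist-pathGraph x y with findᵇ (λ k → reach P k x y) (upTo (suc n)) in eq
  ... | just k with _ , refl , x~>y , below ← findᵇ-applyUpTo-just (λ k → reach P k x y) id (suc n) eq =
    cong just (sym (≤∧≮⇒≡ (reach-sound k x y x~>y) (λ d<k → below d<k (reach-complete _ x y ≤-refl))))
  ... | nothing =
    contradiction (reach-complete _ x y ≤-refl) (findᵇ-applyUpTo-nothing (λ k → reach P k x y) id (suc n) eq d<1+n)
    where
    d<1+n : ∣ toℕ x - toℕ y ∣ < suc n
    d<1+n = s≤s (≤-trans (∣m-n∣≤m⊔n (toℕ x) (toℕ y)) (⊔-lub (<⇒≤ (toℕ<n x)) (<⇒≤ (toℕ<n y))))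

  inInterval-pathGraph : ∀ (x y z : Fin n) →
    T (inInterval P x y z) ⇔ ∣ toℕ x - toℕ z ∣ + ∣ toℕ z - toℕ y ∣ ≡ ∣ toℕ x - toℕ y ∣
  inInterval-pathGraph x y z rewrite dist-pathGraph x y | dist-pathGraph x z | dist-pathGraph z y = T-≡ᵇ _ _

  closure-Extremes : ∀ {S l r} → Extremes S l r → ∀ z →
                     T (closure P S z) ⇔ (toℕ l ≤ toℕ z × toℕ z ≤ toℕ r)
  closure-Extremes {S} {l} {r} ext z = mk⇔ inside interval⊆closure
    where
    open Extremes ext
    inside : T (closure P S z) → toℕ l ≤ toℕ z × toℕ z ≤ toℕ r
    inside h =
      let x , hx = anyV⁻ _ h ; y , hy = anyV⁻ _ hx ; x∈ , rest = T-∧ .to hy ; y∈ , z∈I = T-∧ .to rest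
          geodesic = inInterval-pathGraph x y z .to z∈I
      in ≤-trans (⊓-glb (proj₁ (bounded x∈)) (proj₁ (bounded y∈))) (geodesic⇒⊓≤ _ _ _ geodesic)
       , ≤-trans (geodesic⇒≤⊔ _ _ _ geodesic) (⊔-lub (proj₂ (bounded x∈)) (proj₂ (bounded y∈)))
    interval⊆closure : toℕ l ≤ toℕ z × toℕ z ≤ toℕ r → T (closure P S z)
    interval⊆closure (l≤z , z≤r) = anyV⁺ _ {l} (anyV⁺ _ {r}
      (T-∧ .from (least , T-∧ .from (greatest , inInterval-pathGraph l r z .from (∣-∣-between l≤z z≤r)))))

  ∈-moves-Extremes : ∀ {S l r v} → Extremes S l r → v ∈ moves P S ⇔ (toℕ v < toℕ l ⊎ toℕ r < toℕ v)
  ∈-moves-Extremes {S} {l} {r} {v} ext = mk⇔ (outside ∘ ∈-moves {G = P} {S} .to) (∈-moves {G = P} {S} .from ∘ not-inside)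
    where
    outside : ¬ T (closure P S v) → toℕ v < toℕ l ⊎ toℕ r < toℕ v
    outside v∉ with toℕ v <? toℕ l | toℕ r <? toℕ v
    ... | yes v<l | _       = inj₁ v<l
    ... | no _    | yes r<v = inj₂ r<v
    ... | no v≮l  | no r≮v  = contradiction (closure-Extremes ext v .from (≮⇒≥ v≮l , ≮⇒≥ r≮v)) v∉
    not-inside : toℕ v < toℕ l ⊎ toℕ r < toℕ v → ¬ T (closure P S v)
    not-inside out v∈ = let l≤v , v≤r = closure-Extremes ext v .to v∈ in
      [ (λ v<l → <⇒≱ v<l l≤v) , (λ r<v → <⇒≱ r<v v≤r) ]′ out

  -- The two heaps are the numbers toℕ l and toℕ (opposite r) = n − 1 − toℕ r
  -- of free vertices on either side of the selected interval.
  grundy-Extremes : ∀ f {S l r} → Extremes S l r → toℕ l + toℕ (opposite r) ≤ f →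
                    CappedNim (toℕ l) (toℕ (opposite r)) (grundyF P f S)
  grundy-Extremes zero {l = l} {r} _ a+b≤0 =
    same (trans (n≤0⇒n≡0 (m+n≤o⇒m≤o (toℕ l) a+b≤0)) (sym (n≤0⇒n≡0 (m+n≤o⇒n≤o (toℕ l) a+b≤0))))
  grundy-Extremes (suc f) {S} {l} {r} ext a+b≤1+f =
    mex-CappedNim (record { sound = sound ; left = left ; right = right })
    where
    a b : ℕ
    a = toℕ l
    b = toℕ (opposite r)

    value : Fin n → ℕ
    value v = grundyF P f (S ⊕ v)

    values : List ℕ
    values = map value (moves P S)

    value∈ : ∀ {v} → toℕ v < a ⊎ toℕ r < toℕ v → value v ∈ values
    value∈ = ∈-map⁺ value ∘ ∈-moves-Extremes ext .from

    value-left : ∀ {v} → toℕ v < a → CappedNim (toℕ v) b (value v)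
    value-left v<l = grundy-Extremes f (Extremes-⊕ˡ ext v<l) (≤-pred (≤-trans (+-monoˡ-< b v<l) a+b≤1+f))

    value-right : ∀ {v} → toℕ r < toℕ v → CappedNim a (toℕ (opposite v)) (value v)
    value-right r<v = grundy-Extremes f (Extremes-⊕ʳ ext r<v) (≤-pred (≤-trans (+-monoʳ-< a (opposite-< r<v)) a+b≤1+f))

    sound : ∀ {g} → g ∈ values → (∃ λ a′ → a′ < a × CappedNim a′ b g) ⊎ (∃ λ b′ → b′ < b × CappedNim a b′ g)
    sound g∈ with ∈-map⁻ value g∈
    ... | v , v∈ , refl with ∈-moves-Extremes ext .to v∈
    ...   | inj₁ v<l = inj₁ (toℕ v , v<l , value-left v<l)
    ...   | inj₂ r<v = inj₂ (toℕ (opposite v) , opposite-< r<v , value-right r<v)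

    left : ∀ {a′} → a′ < a → ∃ λ g → g ∈ values × CappedNim a′ b g
    left {a′} a′<a = value v , value∈ (inj₁ v<l) , subst (λ x → CappedNim x b (value v)) toℕ-v (value-left v<l)
      where
      a′<n : a′ < n
      a′<n = <-trans a′<a (toℕ<n l)
      v : Fin n
      v = fromℕ< a′<n
      toℕ-v : toℕ v ≡ a′
      toℕ-v = toℕ-fromℕ< a′<n
      v<l : toℕ v < a
      v<l = subst (_< a) (sym toℕ-v) a′<a

    right : ∀ {b′} → b′ < b → ∃ λ g → g ∈ values × CappedNim a b′ g
    right {b′} b′<b = value v , value∈ (inj₂ r<v) , subst (λ y → CappedNim a y (value v)) toℕ-opposite-v (value-right r<v)
      where
      b′<n : b′ < n
      b′<n = <-trans b′<b (toℕ<n (opposite r))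
      w : Fin n
      w = fromℕ< b′<n
      v : Fin n
      v = opposite w
      toℕ-opposite-v : toℕ (opposite v) ≡ b′
      toℕ-opposite-v = trans (cong toℕ (opposite-involutive w)) (toℕ-fromℕ< b′<n)
      r<v : toℕ r < toℕ v
      r<v = subst₂ _<_ (cong toℕ (opposite-involutive r)) (cong toℕ (opposite-involutive v))
                   (opposite-< (subst (_< b) (sym toℕ-opposite-v) b′<b))

firstMoveValue : ∀ m → Fin (suc m) → ℕ
firstMoveValue m v = grundyF (pathGraph (suc m)) m (∅ ⊕ v)

firstMoveValues : ℕ → List ℕ
firstMoveValues m = map (firstMoveValue m) (moves (pathGraph (suc m)) ∅)

firstMove∈ : ∀ {m} (v : Fin (suc m)) → firstMoveValue m v ∈ firstMoveValues m
firstMove∈ {m} v = ∈-map⁺ (firstMoveValue m) (∈-moves {G = pathGraph (suc m)} {∅} {v} .from (closure-∅ (pathGraph (suc m)) v))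

grundy-first-move : ∀ {m} (v : Fin (suc m)) → CappedNim (toℕ v) (toℕ (opposite v)) (firstMoveValue m v)
grundy-first-move v = grundy-Extremes _ (Extremes-singleton v) (≤-reflexive (toℕ+toℕ-opposite v))

firstMove-CappedNim : ∀ {m g} → g ∈ firstMoveValues m → ∃ λ (v : Fin (suc m)) → CappedNim (toℕ v) (toℕ (opposite v)) g
firstMove-CappedNim g∈ with v , _ , refl ← ∈-map⁻ _ g∈ = v , grundy-first-move v

firstMove-0⇒even : ∀ {m} → 0 ∈ firstMoveValues m → m % 2 ≡ 0
firstMove-0⇒even 0∈ = let v , c = firstMove-CappedNim 0∈ in
  trans (cong (_% 2) (sym (toℕ+toℕ-opposite v))) (CappedNim-0-even c)

firstMove-1⇒odd : ∀ {m} → 1 ∈ firstMoveValues m → m % 2 ≡ 1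
firstMove-1⇒odd 1∈ = let v , c = firstMove-CappedNim 1∈ in
  trans (cong (_% 2) (sym (toℕ+toℕ-opposite v))) (CappedNim-1-odd c)

middleMove : ∀ k → 0 ∈ firstMoveValues (k * 2)
middleMove k = subst (_∈ firstMoveValues (k * 2)) (CappedNim-≡⇒0 balanced (grundy-first-move v)) (firstMove∈ v)
  where
  k<n : k < suc (k * 2)
  k<n = s≤s (subst (k ≤_) (sym (n*2≡n+n k)) (m≤m+n k k))
  v : Fin (suc (k * 2))
  v = fromℕ< k<n
  balanced : toℕ v ≡ toℕ (opposite v)
  balanced = trans (toℕ-fromℕ< k<n) (sym (+-cancelˡ-≡ k _ _ (begin
    k + toℕ (opposite v)     ≡⟨ cong (_+ toℕ (opposite v)) (toℕ-fromℕ< k<n) ⟨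
    toℕ v + toℕ (opposite v) ≡⟨ toℕ+toℕ-opposite v ⟩
    k * 2                    ≡⟨ n*2≡n+n k ⟩
    k + k                    ∎)))
    where open ≡-Reasoning

data Parity : ℕ → Set where
  even : ∀ k → Parity (k * 2)
  odd  : ∀ k → Parity (suc (k * 2))

parity : ∀ n → Parity n
parity zero = even 0
parity (suc n) with parity n
... | even k = odd k
... | odd k  = even (suc k)

theorem4 : (n : ℕ) → 0 < n → 𝒢 (pathGraph n) ≡ n % 2
theorem4 (suc m) _ with parity m
... | even k = begin
  mex (firstMoveValues (k * 2)) ≡⟨ mex≡1 (middleMove k) (λ 1∈ → 0≢1+n (trans (sym (m*n%n≡0 k 2)) (firstMove-1⇒odd {k * 2} 1∈))) ⟩
  1                             ≡⟨ [m+kn]%n≡m%n 1 k 2 ⟨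
  suc (k * 2) % 2               ∎
  where open ≡-Reasoning
... | odd k = begin
  mex (firstMoveValues (suc (k * 2))) ≡⟨ mex≡0 (λ 0∈ → 0≢1+n (trans (sym (firstMove-0⇒even {suc (k * 2)} 0∈)) ([m+kn]%n≡m%n 1 k 2))) ⟩
  0                                   ≡⟨ m*n%n≡0 (suc k) 2 ⟨
  suc (suc (k * 2)) % 2               ∎
  where open ≡-Reasoning
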